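{- Let $\Gamma$ and $\Gamma^\dagger$ be Abelian groups, and let $G$ and $G^\dagger$ be graphs. Suppose $G$ is $\Gamma$-vertex magic with a labeling $\ell$ and magic constant $g$ such that $\ell(x)=g$ for all $x\in V(G)$, and $G^\dagger$ is $\Gamma^\dagger$-vertex magic with a labeling $\ell^\dagger$ and magic constant $g^\dagger$ such that $\sum_{y\in V(G^\dagger)}\ell^\dagger(y)=g^\dagger$. Then the corona product $G\odot G^\dagger$ is $\Gamma\times\Gamma^\dagger$-vertex magic.
   Context: Graphs are finite, simple and undirected. For an additive Abelian group $\Gamma$ with identity $0$ and a graph $G$, a $\Gamma$-vertex magic labeling is a map $\ell:V(G)\to\Gamma\setminus\{0\}$ for which there is $\mu\in\Gamma$ (the magic constant) with $w(v)=\sum_{u\in N(v)}\ell(u)=\mu$ for every vertex $v$; $G$ is $\Gamma$-vertex magic if it has such a labeling. $\Gamma\times\Gamma^\dagger$ is the direct product with componentwise addition. The corona product $G\odot H$ is obtained from one copy of $G$ and $|V(G)|$ copies of $H$ by joining the $i$-th vertex of $G$ by an edge to every vertex of the $i$-th copy of $H$. -}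

module Defs where

open import Level using (Level)
open import Data.Nat using (ℕ; zero; suc; _+_; _*_)
open import Data.Fin using (Fin; zero; suc; splitAt; remQuot; _≟_)
open import Data.Bool using (Bool; true; false; _∧_; if_then_else_)
open import Data.Sum using (_⊎_; inj₁; inj₂)
open import Data.Product using (_×_; _,_; Σ)
open import Relation.Nullary using (¬_; does; yes; no)
open import Relation.Binary.PropositionalEquality using (_≡_; refl; sym; cong₂)
open import Algebra.Bundles using (AbelianGroup)

record Graph : Set where
  field
    order   : ℕ
    adj     : Fin order → Fin order → Bool
    adj-sym : ∀ u v → adj u v ≡ adj v u
    adj-irr : ∀ v → adj v v ≡ false
open Graph public

_==_ : ∀ {n} → Fin n → Fin n → Bool
i == j = does (i ≟ j)

==-sym : ∀ {n} (i j : Fin n) → (i == j) ≡ (j == i)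
==-sym i j with i ≟ j | j ≟ i
... | yes _ | yes _ = refl
... | no _ | no _ = refl
... | yes refl | no ¬p = Data.Empty.⊥-elim (¬p refl) where import Data.Empty
... | no ¬p | yes refl = Data.Empty.⊥-elim (¬p refl) where import Data.Empty

==-refl : ∀ {n} (i : Fin n) → (i == i) ≡ true
==-refl i with i ≟ i
... | yes _ = refl
... | no ¬p = Data.Empty.⊥-elim (¬p refl) where import Data.Empty

-- Vertices of G ⊙ H: Fin (n + n * m); the first n are the vertices of G,
-- the vertex indexed via remQuot by (i , y) is vertex y of the i-th copy of H.
CVert : ℕ → ℕ → Set
CVert n m = Fin n ⊎ (Fin n × Fin m)

decode : ∀ n m → Fin (n + n * m) → CVert n m
decode n m v with splitAt n v
... | inj₁ i = inj₁ i
... | inj₂ p = inj₂ (remQuot m p)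

cadj : ∀ {n m} → (Fin n → Fin n → Bool) → (Fin m → Fin m → Bool) →
       CVert n m → CVert n m → Bool
cadj aG aH (inj₁ i) (inj₁ j) = aG i j
cadj aG aH (inj₁ i) (inj₂ (j , y)) = i == j
cadj aG aH (inj₂ (i , y)) (inj₁ j) = i == j
cadj aG aH (inj₂ (i , y)) (inj₂ (j , z)) = (i == j) ∧ aH y z

cadj-sym : ∀ {n m} (aG : Fin n → Fin n → Bool) (aH : Fin m → Fin m → Bool) →
           (∀ u v → aG u v ≡ aG v u) → (∀ u v → aH u v ≡ aH v u) →
           ∀ a b → cadj aG aH a b ≡ cadj aG aH b a
cadj-sym aG aH sG sH (inj₁ i) (inj₁ j) = sG i j
cadj-sym aG aH sG sH (inj₁ i) (inj₂ (j , y)) = ==-sym i j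
cadj-sym aG aH sG sH (inj₂ (i , y)) (inj₁ j) = ==-sym i j
cadj-sym aG aH sG sH (inj₂ (i , y)) (inj₂ (j , z)) = cong₂ _∧_ (==-sym i j) (sH y z)

cadj-irr : ∀ {n m} (aG : Fin n → Fin n → Bool) (aH : Fin m → Fin m → Bool) →
           (∀ v → aG v v ≡ false) → (∀ v → aH v v ≡ false) →
           ∀ a → cadj aG aH a a ≡ false
cadj-irr aG aH iG iH (inj₁ i) = iG i
cadj-irr aG aH iG iH (inj₂ (i , y)) with i == i
... | true = iH y
... | false = refl

corona : Graph → Graph → Graph
corona G H = record
  { order   = n + n * m
  ; adj     = λ u v → cadj (adj G) (adj H) (decode n m u) (decode n m v)
  ; adj-sym = λ u v → cadj-sym (adj G) (adj H) (adj-sym G) (adj-sym H) (decode n m u) (decode n m v)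
  ; adj-irr = λ v → cadj-irr (adj G) (adj H) (adj-irr G) (adj-irr H) (decode n m v)
  }
  where
  n = order G
  m = order H

module _ {c ℓ : Level} (Γ : AbelianGroup c ℓ) where
  open AbelianGroup Γ

  ∑ : ∀ {n} → (Fin n → Carrier) → Carrier
  ∑ {zero} f = ε
  ∑ {suc n} f = f zero ∙ ∑ (λ i → f (suc i))

  weight : (G : Graph) → (Fin (order G) → Carrier) → Fin (order G) → Carrier
  weight G l v = ∑ (λ u → if adj G v u then l u else ε)

  IsMagicLabeling : (G : Graph) → (Fin (order G) → Carrier) → Carrier → Set ℓ
  IsMagicLabeling G l μ = (∀ v → ¬ (l v ≈ ε)) × (∀ v → weight G l v ≈ μ)

  VertexMagic : Graph → Set (c Level.⊔ ℓ)
  VertexMagic G = Σ (Fin (order G) → Carrier) λ l → Σ Carrier λ μ → IsMagicLabeling G l μ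

{-# OPTIONS --safe #-}
-- Label each vertex x of G by (ℓ x , 0) and vertex y of every copy of G† by
-- (0 , ℓ† y).  A vertex x of G is adjacent to its neighbours in G, whose first
-- coordinates sum to g, and to its whole copy of G†, whose second coordinates
-- sum to g†.  A vertex y of the copy hanging at x is adjacent to x, which
-- contributes ℓ x = g, and to its neighbours in the copy, which contribute
-- w†(y) = g†.  So every weight is (g , g†).
module Submission where

open import Defs
open import Level using (Level)
open import Function using (_∘_)
open import Data.Nat using (zero; suc; _+_; _*_)
open import Data.Fin using (Fin; zero; suc; _↑ˡ_; _↑ʳ_; combine)
open import Data.Fin.Properties using (splitAt-↑ˡ; splitAt-↑ʳ; remQuot-combine)
open import Data.Bool using (Bool; true; false; _∧_; if_then_else_)
open import Data.Bool.Properties using (if-float; if-eta; if-∧)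
open import Data.Sum using (inj₁; inj₂)
open import Data.Product using (_×_; _,_; proj₁; proj₂)
open import Relation.Binary.PropositionalEquality as ≡ using (_≡_)
open import Relation.Nullary using (¬_)
open import Algebra.Bundles using (AbelianGroup)
open import Algebra.Construct.DirectProduct using (abelianGroup)

decode-↑ˡ : ∀ n m (i : Fin n) → decode n m (i ↑ˡ (n * m)) ≡ inj₁ i
decode-↑ˡ n m i rewrite splitAt-↑ˡ n i (n * m) = ≡.refl

decode-↑ʳ : ∀ n m (i : Fin n) (y : Fin m) → decode n m (n ↑ʳ combine i y) ≡ inj₂ (i , y)
decode-↑ʳ n m i y rewrite splitAt-↑ʳ n (n * m) (combine i y) | remQuot-combine {n} {m} i y = ≡.refl

module SumProperties {c ℓ : Level} (A : AbelianGroup c ℓ) where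
  open AbelianGroup A

  ∑-cong : ∀ {n} {f g : Fin n → Carrier} → (∀ i → f i ≈ g i) → ∑ A f ≈ ∑ A g
  ∑-cong {zero} f≈g = refl
  ∑-cong {suc n} f≈g = ∙-cong (f≈g zero) (∑-cong (f≈g ∘ suc))

  ∑-ε : ∀ {n} → ∑ A {n} (λ _ → ε) ≈ ε
  ∑-ε {zero} = refl
  ∑-ε {suc n} = trans (∙-cong refl (∑-ε {n})) (identityˡ ε)

  ∑-if-ε : ∀ {n} (b : Fin n → Bool) → ∑ A (λ j → if b j then ε else ε) ≈ ε
  ∑-if-ε {n} b = trans (∑-cong (λ j → reflexive (if-eta (b j)))) (∑-ε {n})

  ∑-if : ∀ {n} (b : Bool) (f : Fin n → Carrier) →
         ∑ A (λ j → if b then f j else ε) ≈ (if b then ∑ A f else ε)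
  ∑-if true f = refl
  ∑-if {n} false f = ∑-ε {n}

  ∑-δ : ∀ {n} (i : Fin n) (f : Fin n → Carrier) → ∑ A (λ j → if i == j then f j else ε) ≈ f i
  ∑-δ {suc n} zero f = trans (∙-cong refl (∑-ε {n})) (identityʳ _)
  ∑-δ {suc n} (suc i) f = trans (identityˡ _) (∑-δ i (f ∘ suc))

  ∑-↑ : ∀ n k (f : Fin (n + k) → Carrier) →
        ∑ A f ≈ ∑ A (λ i → f (i ↑ˡ k)) ∙ ∑ A (λ j → f (n ↑ʳ j))
  ∑-↑ zero k f = sym (identityˡ _)
  ∑-↑ (suc n) k f = trans (∙-cong refl (∑-↑ n k (f ∘ suc))) (sym (assoc _ _ _))

  ∑-combine : ∀ n m (f : Fin (n * m) → Carrier) →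
              ∑ A f ≈ ∑ A {n} (λ i → ∑ A {m} (λ y → f (combine i y)))
  ∑-combine zero m f = refl
  ∑-combine (suc n) m f = trans (∑-↑ m (n * m) f) (∙-cong refl (∑-combine n m (f ∘ (m ↑ʳ_))))

  ∑-decode : ∀ n m (F : CVert n m → Carrier) →
             ∑ A (F ∘ decode n m) ≈ ∑ A (F ∘ inj₁) ∙ ∑ A {n} (λ i → ∑ A {m} (λ y → F (inj₂ (i , y))))
  ∑-decode n m F = trans (∑-↑ n (n * m) _)
    (∙-cong (∑-cong (λ i → reflexive (≡.cong F (decode-↑ˡ n m i))))
            (trans (∑-combine n m _) (∑-cong (λ i → ∑-cong (λ y → reflexive (≡.cong F (decode-↑ʳ n m i y)))))))

-- A labeling of G ⊙ H is given as a function on CVert; ⊙-weight L (decode v) is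
-- definitionally the weight of v under L ∘ decode.
module CoronaWeights {c ℓ : Level} (A : AbelianGroup c ℓ) (G H : Graph) where
  open AbelianGroup A
  open SumProperties A

  private
    n = order G
    m = order H
    adj⊙ = cadj {n} {m} (adj G) (adj H)

  ⊙-weight : (CVert n m → Carrier) → CVert n m → Carrier
  ⊙-weight L a = ∑ A (λ u → if adj⊙ a (decode n m u) then L (decode n m u) else ε)

  baseLabel : (Fin n → Carrier) → CVert n m → Carrier
  baseLabel l (inj₁ i) = l i
  baseLabel l (inj₂ _) = ε

  copyLabel : (Fin m → Carrier) → CVert n m → Carrier
  copyLabel l (inj₁ _) = ε
  copyLabel l (inj₂ (_ , y)) = l y

  ⊙-weight-split : ∀ L a →
    ⊙-weight L a ≈ ∑ A (λ i → if adj⊙ a (inj₁ i) then L (inj₁ i) else ε)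
                 ∙ ∑ A {n} (λ i → ∑ A {m} (λ y → if adj⊙ a (inj₂ (i , y)) then L (inj₂ (i , y)) else ε))
  ⊙-weight-split L a = ∑-decode n m (λ b → if adj⊙ a b then L b else ε)

  ⊙-weight-baseLabel : ∀ l a → ⊙-weight (baseLabel l) a ≈ ∑ A (λ i → if adj⊙ a (inj₁ i) then l i else ε)
  ⊙-weight-baseLabel l a = trans (⊙-weight-split (baseLabel l) a) (trans (∙-cong refl copies≈ε) (identityʳ _))
    where
    copies≈ε : ∑ A {n} (λ i → ∑ A {m} (λ y → if adj⊙ a (inj₂ (i , y)) then ε else ε)) ≈ ε
    copies≈ε = trans (∑-cong (λ i → ∑-if-ε (λ y → adj⊙ a (inj₂ (i , y))))) (∑-ε {n})

  ⊙-weight-copyLabel : ∀ l a →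
    ⊙-weight (copyLabel l) a ≈ ∑ A {n} (λ i → ∑ A (λ y → if adj⊙ a (inj₂ (i , y)) then l y else ε))
  ⊙-weight-copyLabel l a = trans (⊙-weight-split (copyLabel l) a)
    (trans (∙-cong (∑-if-ε (λ i → adj⊙ a (inj₁ i))) refl) (identityˡ _))

  ⊙-weight-baseLabel-inj₂ : ∀ l i y → ⊙-weight (baseLabel l) (inj₂ (i , y)) ≈ l i
  ⊙-weight-baseLabel-inj₂ l i y = trans (⊙-weight-baseLabel l (inj₂ (i , y))) (∑-δ i l)

  ⊙-weight-copyLabel-inj₁ : ∀ l i → ⊙-weight (copyLabel l) (inj₁ i) ≈ ∑ A l
  ⊙-weight-copyLabel-inj₁ l i = trans (⊙-weight-copyLabel l (inj₁ i))
    (trans (∑-cong (λ j → ∑-if (i == j) l)) (∑-δ i (λ _ → ∑ A l)))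

  ⊙-weight-copyLabel-inj₂ : ∀ l i y → ⊙-weight (copyLabel l) (inj₂ (i , y)) ≈ weight A H l y
  ⊙-weight-copyLabel-inj₂ l i y = trans (⊙-weight-copyLabel l (inj₂ (i , y)))
    (trans (∑-cong inner) (∑-δ i (λ _ → weight A H l y)))
    where
    inner : ∀ j → ∑ A (λ z → if (i == j) ∧ adj H y z then l z else ε) ≈ (if i == j then weight A H l y else ε)
    inner j = trans (∑-cong {m} (λ z → reflexive (if-∧ (i == j) {adj H y z})))
                    (∑-if (i == j) (λ z → if adj H y z then l z else ε))

module DirectProductWeights {c₁ ℓ₁ c₂ ℓ₂ : Level} (A : AbelianGroup c₁ ℓ₁) (B : AbelianGroup c₂ ℓ₂) where
  private
    A×B = abelianGroup A B
    module A = AbelianGroup A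
    module B = AbelianGroup B
    module A×B = AbelianGroup A×B

  ∑-proj₁ : ∀ {n} (F : Fin n → A×B.Carrier) → proj₁ (∑ A×B F) ≡ ∑ A (proj₁ ∘ F)
  ∑-proj₁ {zero} F = ≡.refl
  ∑-proj₁ {suc n} F = ≡.cong (proj₁ (F zero) A.∙_) (∑-proj₁ (F ∘ suc))

  ∑-proj₂ : ∀ {n} (F : Fin n → A×B.Carrier) → proj₂ (∑ A×B F) ≡ ∑ B (proj₂ ∘ F)
  ∑-proj₂ {zero} F = ≡.refl
  ∑-proj₂ {suc n} F = ≡.cong (proj₂ (F zero) B.∙_) (∑-proj₂ (F ∘ suc))

  weight-× : ∀ G (L : Fin (order G) → A×B.Carrier) {μ₁ μ₂} →
             (∀ v → weight A G (proj₁ ∘ L) v A.≈ μ₁) → (∀ v → weight B G (proj₂ ∘ L) v B.≈ μ₂) →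
             ∀ v → weight A×B G L v A×B.≈ (μ₁ , μ₂)
  weight-× G L w₁ w₂ v =
    A.trans (A.reflexive (∑-proj₁ (λ u → if adj G v u then L u else A×B.ε)))
      (A.trans (SumProperties.∑-cong A (λ u → A.reflexive (if-float proj₁ (adj G v u)))) (w₁ v)) ,
    B.trans (B.reflexive (∑-proj₂ (λ u → if adj G v u then L u else A×B.ε)))
      (B.trans (SumProperties.∑-cong B (λ u → B.reflexive (if-float proj₂ (adj G v u)))) (w₂ v))

theorem3p4 : ∀ {c₁ ℓ₁ c₂ ℓ₂ : Level} (Γ : AbelianGroup c₁ ℓ₁) (Γ† : AbelianGroup c₂ ℓ₂) (G G† : Graph)
    (l : Fin (Graph.order G) → AbelianGroup.Carrier Γ) (g : AbelianGroup.Carrier Γ)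
    (l† : Fin (Graph.order G†) → AbelianGroup.Carrier Γ†) (g† : AbelianGroup.Carrier Γ†) →
    IsMagicLabeling Γ G l g → (∀ x → AbelianGroup._≈_ Γ (l x) g) →
    IsMagicLabeling Γ† G† l† g† → AbelianGroup._≈_ Γ† (∑ Γ† l†) g† →
    VertexMagic (abelianGroup Γ Γ†) (corona G G†)
theorem3p4 Γ Γ† G G† l g l† g† (l≉ε , wl≈g) l≈g (l†≉ε , wl†≈g†) ∑l†≈g† =
  label , (g , g†) , label≉ε ,
  DirectProductWeights.weight-× Γ Γ† (corona G G†) label
    (λ v → base-magic (decode n m v)) (λ v → copy-magic (decode n m v))
  where
  module Γ = AbelianGroup Γ
  module Γ† = AbelianGroup Γ†
  module ⊙ = CoronaWeights Γ G G†
  module ⊙† = CoronaWeights Γ† G G†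
  n = order G
  m = order G†

  label : Fin (n + n * m) → Γ.Carrier × Γ†.Carrier
  label u = ⊙.baseLabel l (decode n m u) , ⊙†.copyLabel l† (decode n m u)

  label≉ε : ∀ u → ¬ AbelianGroup._≈_ (abelianGroup Γ Γ†) (label u) (Γ.ε , Γ†.ε)
  label≉ε u with decode n m u
  ... | inj₁ i = λ e → l≉ε i (proj₁ e)
  ... | inj₂ (_ , y) = λ e → l†≉ε y (proj₂ e)

  base-magic : ∀ a → ⊙.⊙-weight (⊙.baseLabel l) a Γ.≈ g
  base-magic (inj₁ i) = Γ.trans (⊙.⊙-weight-baseLabel l (inj₁ i)) (wl≈g i)
  base-magic (inj₂ (i , y)) = Γ.trans (⊙.⊙-weight-baseLabel-inj₂ l i y) (l≈g i)

  copy-magic : ∀ a → ⊙†.⊙-weight (⊙†.copyLabel l†) a Γ†.≈ g†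
  copy-magic (inj₁ i) = Γ†.trans (⊙†.⊙-weight-copyLabel-inj₁ l† i) ∑l†≈g†
  copy-magic (inj₂ (i , y)) = Γ†.trans (⊙†.⊙-weight-copyLabel-inj₂ l† i y) (wl†≈g† y)
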